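{- Let $\psi=(a_1,a_2,a_3,b_1,b_2,b_3)\in\mathbb{R}^6$ be such that the matrix $V=\mathcal{V}(\psi)$ satisfies $V_{ij}>0$ whenever $i\notin\{j-1,j\}$, and let $\alpha_1(t),\alpha_2(t),\alpha_3(t),\beta_1(t),\beta_2(t),\beta_3(t)$ ($t=0,1,2,\dots$) be the sequences defined from $\psi$ as in the context. Then $\alpha_1(7)=a_1$, $\alpha_2(7)=a_2$, $\alpha_3(7)=a_3$, $\beta_1(7)=b_1$, $\beta_2(7)=b_2$, $\beta_3(7)=b_3$.
   Context: Row and column indices of all $7$-row or $7$-column matrices are elements of $\mathbb{Z}/7\mathbb{Z}$. For $\alpha=(a_1,a_2,a_3,b_1,b_2,b_3)$ let $W(\alpha)$ be the $7$-by-$3$ matrix whose rows are, in order, $(0,1,1)$, $(0,0,1)$, $(1,0,0)$, $(1,1,0)$, $(a_1,1,b_1)$, $(a_2,1,b_2)$, $(a_3,1,b_3)$; for rows $r,s,t$, $W[r,s,t]$ is the $3\times3$ submatrix formed by rows $r,s,t$ in that order; $\mathcal{V}(\alpha)$ is the $7$-by-$7$ matrix with $(i,j)$ entry $\det W(\alpha)[i-1,\,j-2,\,j-1]$. Sequences: $\alpha_\chi(0)=a_\chi$, $\beta_\chi(0)=b_\chi$ for $\chi=1,2,3$, and for $t\geq0$: $\alpha_1(t+1)=\frac{1-\alpha_3(t)-\beta_3(t)}{1-\beta_3(t)}$; for $\chi\in\{1,2\}$, $\alpha_{\chi+1}(t+1)=\frac{\alpha_\chi(t)-\alpha_\chi(t)\beta_3(t)-\alpha_3(t)+\alpha_3(t)\beta_\chi(t)}{\alpha_\chi(t)-\alpha_\chi(t)\beta_3(t)}$;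 $\beta_1(t+1)=\alpha_3(t)$, $\beta_2(t+1)=\alpha_3(t)/\alpha_1(t)$, $\beta_3(t+1)=\alpha_3(t)/\alpha_2(t)$. Under the hypothesis on $\psi$, each vector $(\alpha_1(t),\dots,\beta_3(t))$ again satisfies the same positivity hypothesis, so all denominators are nonzero and the sequences are well defined. -}

module Defs where

open import Level using (Level; _⊔_; suc)
open import Algebra.Bundles using (CommutativeRing)
open import Relation.Binary.Structures using (IsStrictTotalOrder)
open import Relation.Nullary using (¬_)
open import Relation.Binary.PropositionalEquality using (_≡_)
open import Data.Nat using (ℕ; zero) renaming (suc to sucℕ)
open import Data.Fin using (Fin)
open import Data.Fin.Patterns using (0F; 1F; 2F; 3F; 4F; 5F; 6F)

-- Division is given by a
-- total inverse 'inv' which is a genuine multiplicative inverse on nonzero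
-- elements (its value at 0 is unspecified).
record OrderedField (c ℓ₁ ℓ₂ : Level) : Set (suc (c ⊔ ℓ₁ ⊔ ℓ₂)) where
  field
    commutativeRing : CommutativeRing c ℓ₁
  open CommutativeRing commutativeRing public
  field
    _<_                : Carrier → Carrier → Set ℓ₂
    isStrictTotalOrder : IsStrictTotalOrder _≈_ _<_
    +-monoˡ-<          : ∀ {x y} z → x < y → (x + z) < (y + z)
    *-pos              : ∀ {x y} → 0# < x → 0# < y → 0# < (x * y)
    0<1                : 0# < 1#
    inv                : Carrier → Carrier
    inv-cong           : ∀ {x y} → x ≈ y → inv x ≈ inv y
    *-inv              : ∀ x → ¬ (x ≈ 0#) → (x * inv x) ≈ 1#

  _÷_ : Carrier → Carrier → Carrier
  x ÷ y = x * inv y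

module _ {c ℓ₁ ℓ₂} (F : OrderedField c ℓ₁ ℓ₂) where
  open OrderedField F

  record Row : Set c where
    constructor row
    field
      r₁ r₂ r₃ : Carrier

  det3 : Row → Row → Row → Carrier
  det3 (row u₁ u₂ u₃) (row v₁ v₂ v₃) (row w₁ w₂ w₃) =
    (u₁ * ((v₂ * w₃) - (v₃ * w₂)))
    - (u₂ * ((v₁ * w₃) - (v₃ * w₁)))
    + (u₃ * ((v₁ * w₂) - (v₂ * w₁)))

  record Param : Set c where
    constructor param
    field
      a₁ a₂ a₃ b₁ b₂ b₃ : Carrier
  open Param public

  W : Param → Fin 7 → Row
  W p 0F = row 0# 1# 1#
  W p 1F = row 0# 0# 1#
  W p 2F = row 1# 0# 0#
  W p 3F = row 1# 1# 0#
  W p 4F = row (a₁ p) 1# (b₁ p)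
  W p 5F = row (a₂ p) 1# (b₂ p)
  W p 6F = row (a₃ p) 1# (b₃ p)

  pred7 : Fin 7 → Fin 7
  pred7 0F = 6F
  pred7 1F = 0F
  pred7 2F = 1F
  pred7 3F = 2F
  pred7 4F = 3F
  pred7 5F = 4F
  pred7 6F = 5F

  𝒱 : Param → Fin 7 → Fin 7 → Carrier
  𝒱 p i j = det3 (W p (pred7 i)) (W p (pred7 (pred7 j))) (W p (pred7 j))

  Positive : Param → Set ℓ₂
  Positive p = ∀ (i j : Fin 7) → ¬ (i ≡ pred7 j) → ¬ (i ≡ j) → 0# < 𝒱 p i j

  -- One step of the recursion, with (α₁,α₂,α₃,β₁,β₂,β₃)(t) stored as a Param.
  step : Param → Param
  step (param x₁ x₂ x₃ y₁ y₂ y₃) = param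
    ((1# - x₃ - y₃) ÷ (1# - y₃))
    (((x₁ - (x₁ * y₃)) - x₃ + (x₃ * y₁)) ÷ (x₁ - (x₁ * y₃)))
    (((x₂ - (x₂ * y₃)) - x₃ + (x₃ * y₂)) ÷ (x₂ - (x₂ * y₃)))
    x₃
    (x₃ ÷ x₁)
    (x₃ ÷ x₂)

  seq : Param → ℕ → Param
  seq p zero     = p
  seq p (sucℕ t) = step (seq p t)

-- The rows of W ψ are seven points of the projective plane, normalised so that
-- the first four are the standard frame and the last three lie in the chart
-- with middle coordinate 1.  One step of the recursion renormalises the
-- cyclically relabelled configuration: each row of W (step ψ) is a nonzero
-- multiple of the previous row of W ψ times an invertible matrix.  After seven
-- steps the labels are back in place, so W (seq ψ 7) and W ψ differ by a linear
-- map that fixes the frame up to scalars; such a map is a scalar, which forces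
-- the normalised coordinates to agree.  The hypothesis enters only through
-- nonvanishing: the minors 𝒱 i j scale by the determinant of the matrix, so
-- they stay nonzero along the orbit and every denominator is nonzero.

module Submission where

open import Defs
open import Level using (Level; _⊔_)
open import Algebra.Bundles using (CommutativeRing; RawRing)
open import Algebra.Solver.Ring.AlmostCommutativeRing
  using (fromCommutativeRing; _-Raw-AlmostCommutative⟶_)
open import Data.Fin using (Fin)
open import Data.Fin.Patterns using (0F; 1F; 2F; 3F; 4F; 5F; 6F)
open import Data.Maybe using (Maybe; just; nothing)
open import Data.Nat as ℕ using (ℕ; zero; suc; _∸_)
open import Data.Product using (_×_; _,_)
open import Data.Product.Properties using (≡-dec)
open import Function using (_∘_)
open import Relation.Nullary using (¬_; yes; no)
open import Relation.Binary.PropositionalEquality as ≡ using (_≡_; _≗_)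
open import Relation.Binary.Structures using (IsStrictTotalOrder)

-- Coefficients from the ring itself would not let the solver cancel x - x.
module IntegerCoefficientSolver {c ℓ} (R : CommutativeRing c ℓ) where
  open CommutativeRing R
  open import Algebra.Properties.Monoid.Mult.TCOptimised +-monoid
    using (×-homo-+; 1+×) renaming (_×_ to _·1_)
  open import Algebra.Properties.Semiring.Mult.TCOptimised semiring using (×1-homo-*)
  open import Algebra.Properties.AbelianGroup +-abelianGroup using (⁻¹-∙-comm; ⁻¹-anti-homo‿-)
  open import Algebra.Properties.Group +-group using (ε⁻¹≈ε)
  open import Algebra.Properties.CommutativeSemigroup +-commutativeSemigroup using (interchange)
  open import Algebra.Properties.Ring ring using (x[y-z]≈xy-xz; [y-z]x≈yx-zx)
  open import Relation.Binary.Reasoning.Setoid setoid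

  -- The pair (p , n) stands for the integer p - n; the semantics is chosen so
  -- that the coefficients (0 , 0) and (1 , 0) denote 0# and 1# definitionally.
  ℤ² : Set
  ℤ² = ℕ × ℕ

  reduce : ℤ² → ℤ²
  reduce (p , n) = (p ∸ n , n ∸ p)

  ⟦_⟧ℤ : ℤ² → Carrier
  ⟦ p     , zero  ⟧ℤ = p ·1 1#
  ⟦ zero  , suc n ⟧ℤ = - (suc n ·1 1#)
  ⟦ suc p , suc n ⟧ℤ = ⟦ p , n ⟧ℤ

  ⟦reduce⟧ : ∀ x → ⟦ reduce x ⟧ℤ ≡ ⟦ x ⟧ℤ
  ⟦reduce⟧ (zero  , zero ) = ≡.refl
  ⟦reduce⟧ (zero  , suc n) = ≡.refl
  ⟦reduce⟧ (suc p , zero ) = ≡.refl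
  ⟦reduce⟧ (suc p , suc n) = ⟦reduce⟧ (p , n)

  [x+y]-[x+z]≈y-z : ∀ x y z → (x + y) - (x + z) ≈ y - z
  [x+y]-[x+z]≈y-z x y z = begin
    (x + y) - (x + z)     ≈⟨ +-congˡ (⁻¹-∙-comm x z) ⟨
    (x + y) + (- x + - z) ≈⟨ interchange x y (- x) (- z) ⟩
    (x - x) + (y - z)     ≈⟨ +-congʳ (-‿inverseʳ x) ⟩
    0# + (y - z)          ≈⟨ +-identityˡ (y - z) ⟩
    y - z                 ∎

  [x+y]-[z+w]≈[x-z]+[y-w] : ∀ x y z w → (x + y) - (z + w) ≈ (x - z) + (y - w)
  [x+y]-[z+w]≈[x-z]+[y-w] x y z w =
    trans (+-congˡ (sym (⁻¹-∙-comm z w))) (interchange x y (- z) (- w))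

  [x-y][z-w]≈[xz+yw]-[xw+yz] : ∀ x y z w → (x - y) * (z - w) ≈ (x * z + y * w) - (x * w + y * z)
  [x-y][z-w]≈[xz+yw]-[xw+yz] x y z w = begin
    (x - y) * (z - w)                     ≈⟨ [y-z]x≈yx-zx (z - w) x y ⟩
    x * (z - w) - y * (z - w)             ≈⟨ +-cong (x[y-z]≈xy-xz x z w) (-‿cong (x[y-z]≈xy-xz y z w)) ⟩
    (x * z - x * w) - (y * z - y * w)     ≈⟨ +-congˡ (⁻¹-anti-homo‿- (y * z) (y * w)) ⟩
    (x * z - x * w) + (y * w - y * z)     ≈⟨ interchange (x * z) (- (x * w)) (y * w) (- (y * z)) ⟩
    (x * z + y * w) + (- (x * w) - y * z) ≈⟨ +-congˡ (⁻¹-∙-comm (x * w) (y * z)) ⟩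
    (x * z + y * w) - (x * w + y * z)     ∎

  ⟦⟧ℤ≈difference : ∀ p n → ⟦ p , n ⟧ℤ ≈ p ·1 1# - n ·1 1#
  ⟦⟧ℤ≈difference p       zero    = sym (trans (+-congˡ ε⁻¹≈ε) (+-identityʳ (p ·1 1#)))
  ⟦⟧ℤ≈difference zero    (suc n) = sym (+-identityˡ _)
  ⟦⟧ℤ≈difference (suc p) (suc n) = begin
    ⟦ p , n ⟧ℤ                       ≈⟨ ⟦⟧ℤ≈difference p n ⟩
    p ·1 1# - n ·1 1#                ≈⟨ [x+y]-[x+z]≈y-z 1# (p ·1 1#) (n ·1 1#) ⟨
    (1# + p ·1 1#) - (1# + n ·1 1#)  ≈⟨ +-cong (1+× p 1#) (-‿cong (1+× n 1#)) ⟨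
    suc p ·1 1# - suc n ·1 1#        ∎

  coefficients : RawRing _ _
  coefficients = record
    { Carrier = ℤ²
    ; _≈_     = _≡_
    ; _+_     = λ { (p , n) (p′ , n′) → reduce (p ℕ.+ p′ , n ℕ.+ n′) }
    ; _*_     = λ { (p , n) (p′ , n′) → reduce (p ℕ.* p′ ℕ.+ n ℕ.* n′ , p ℕ.* n′ ℕ.+ n ℕ.* p′) }
    ; -_      = λ { (p , n) → (n , p) }
    ; 0#      = (0 , 0)
    ; 1#      = (1 , 0)
    }

  homomorphism : coefficients -Raw-AlmostCommutative⟶ fromCommutativeRing R
  homomorphism = record
    { ⟦_⟧    = ⟦_⟧ℤ
    ; +-homo = λ { (p , n) (p′ , n′) → begin
        ⟦ reduce (p ℕ.+ p′ , n ℕ.+ n′) ⟧ℤ           ≡⟨ ⟦reduce⟧ (p ℕ.+ p′ , n ℕ.+ n′) ⟩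
        ⟦ p ℕ.+ p′ , n ℕ.+ n′ ⟧ℤ                    ≈⟨ ⟦⟧ℤ≈difference (p ℕ.+ p′) (n ℕ.+ n′) ⟩
        (p ℕ.+ p′) ·1 1# - (n ℕ.+ n′) ·1 1#         ≈⟨ +-cong (×-homo-+ 1# p p′) (-‿cong (×-homo-+ 1# n n′)) ⟩
        (p ·1 1# + p′ ·1 1#) - (n ·1 1# + n′ ·1 1#) ≈⟨ [x+y]-[z+w]≈[x-z]+[y-w] _ _ _ _ ⟩
        (p ·1 1# - n ·1 1#) + (p′ ·1 1# - n′ ·1 1#) ≈⟨ +-cong (⟦⟧ℤ≈difference p n) (⟦⟧ℤ≈difference p′ n′) ⟨
        ⟦ p , n ⟧ℤ + ⟦ p′ , n′ ⟧ℤ                   ∎ }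
    ; *-homo = λ { (p , n) (p′ , n′) → begin
        ⟦ reduce (p ℕ.* p′ ℕ.+ n ℕ.* n′ , p ℕ.* n′ ℕ.+ n ℕ.* p′) ⟧ℤ
          ≡⟨ ⟦reduce⟧ (p ℕ.* p′ ℕ.+ n ℕ.* n′ , p ℕ.* n′ ℕ.+ n ℕ.* p′) ⟩
        ⟦ p ℕ.* p′ ℕ.+ n ℕ.* n′ , p ℕ.* n′ ℕ.+ n ℕ.* p′ ⟧ℤ
          ≈⟨ ⟦⟧ℤ≈difference (p ℕ.* p′ ℕ.+ n ℕ.* n′) (p ℕ.* n′ ℕ.+ n ℕ.* p′) ⟩
        (p ℕ.* p′ ℕ.+ n ℕ.* n′) ·1 1# - (p ℕ.* n′ ℕ.+ n ℕ.* p′) ·1 1#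
          ≈⟨ +-cong (trans (×-homo-+ 1# (p ℕ.* p′) (n ℕ.* n′)) (+-cong (×1-homo-* p p′) (×1-homo-* n n′)))
                    (-‿cong (trans (×-homo-+ 1# (p ℕ.* n′) (n ℕ.* p′)) (+-cong (×1-homo-* p n′) (×1-homo-* n p′)))) ⟩
        (p ·1 1# * p′ ·1 1# + n ·1 1# * n′ ·1 1#) - (p ·1 1# * n′ ·1 1# + n ·1 1# * p′ ·1 1#)
          ≈⟨ [x-y][z-w]≈[xz+yw]-[xw+yz] _ _ _ _ ⟨
        (p ·1 1# - n ·1 1#) * (p′ ·1 1# - n′ ·1 1#)
          ≈⟨ *-cong (⟦⟧ℤ≈difference p n) (⟦⟧ℤ≈difference p′ n′) ⟨
        ⟦ p , n ⟧ℤ * ⟦ p′ , n′ ⟧ℤ ∎ }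
    ; -‿homo = λ { (p , n) → begin
        ⟦ n , p ⟧ℤ         ≈⟨ ⟦⟧ℤ≈difference n p ⟩
        n ·1 1# - p ·1 1#  ≈⟨ ⁻¹-anti-homo‿- (p ·1 1#) (n ·1 1#) ⟨
        - (p ·1 1# - n ·1 1#) ≈⟨ -‿cong (⟦⟧ℤ≈difference p n) ⟨
        - ⟦ p , n ⟧ℤ       ∎ }
    ; 0-homo = refl
    ; 1-homo = refl
    }

  coefficient? : ∀ x y → Maybe (⟦ x ⟧ℤ ≈ ⟦ y ⟧ℤ)
  coefficient? x y with ≡-dec ℕ._≟_ ℕ._≟_ (reduce x) (reduce y)
  ... | yes eq = just (reflexive (≡.trans (≡.sym (⟦reduce⟧ x)) (≡.trans (≡.cong ⟦_⟧ℤ eq) (⟦reduce⟧ y))))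
  ... | no _   = nothing

  open import Algebra.Solver.Ring coefficients (fromCommutativeRing R) homomorphism coefficient? public

  :0 :1 : ∀ {n} → Polynomial n
  :0 = con (0 , 0)
  :1 = con (1 , 0)

module _ {c ℓ₁ ℓ₂} (F : OrderedField c ℓ₁ ℓ₂) where
  open OrderedField F
  open IntegerCoefficientSolver commutativeRing using (solve; _:=_; _:+_; _:*_; _:-_; :-_; :0; :1; Polynomial)
  open import Algebra.Properties.CommutativeSemigroup *-commutativeSemigroup using (x∙yz≈y∙xz)
  open import Relation.Binary.Reasoning.Setoid setoid
  open IsStrictTotalOrder isStrictTotalOrder using (irrefl)

  *-≉0 : ∀ {x y} → x ≉ 0# → y ≉ 0# → x * y ≉ 0#
  *-≉0 {x} {y} x≉0 y≉0 xy≈0 = y≉0 (begin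
    y               ≈⟨ *-identityˡ y ⟨
    1# * y          ≈⟨ *-congʳ (trans (*-comm (inv x) x) (*-inv x x≉0)) ⟨
    inv x * x * y   ≈⟨ *-assoc (inv x) x y ⟩
    inv x * (x * y) ≈⟨ *-congˡ xy≈0 ⟩
    inv x * 0#      ≈⟨ zeroʳ (inv x) ⟩
    0#              ∎)

  *-÷-cancel : ∀ {x} y → x ≉ 0# → x * (y ÷ x) ≈ y
  *-÷-cancel {x} y x≉0 = begin
    x * (y * inv x) ≈⟨ x∙yz≈y∙xz x y (inv x) ⟩
    y * (x * inv x) ≈⟨ *-congˡ (*-inv x x≉0) ⟩
    y * 1#          ≈⟨ *-identityʳ y ⟩
    y               ∎

  *-cancelˡ : ∀ {x y z} → x ≉ 0# → x * y ≈ x * z → y ≈ z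
  *-cancelˡ {x} {y} {z} x≉0 xy≈xz = begin
    y               ≈⟨ *-÷-cancel y x≉0 ⟨
    x * (y * inv x) ≈⟨ *-assoc x y (inv x) ⟨
    x * y * inv x   ≈⟨ *-congʳ xy≈xz ⟩
    x * z * inv x   ≈⟨ *-assoc x z (inv x) ⟩
    x * (z * inv x) ≈⟨ *-÷-cancel z x≉0 ⟩
    z               ∎

  infix 4 _≋_
  _≋_ : Row F → Row F → Set ℓ₁
  row x y z ≋ row x′ y′ z′ = (x ≈ x′) × (y ≈ y′) × (z ≈ z′)

  ≋-trans : ∀ {u v w} → u ≋ v → v ≋ w → u ≋ w
  ≋-trans {row _ _ _} {row _ _ _} {row _ _ _} (p₁ , p₂ , p₃) (q₁ , q₂ , q₃) =
    trans p₁ q₁ , trans p₂ q₂ , trans p₃ q₃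

  ≋-sym : ∀ {u v} → u ≋ v → v ≋ u
  ≋-sym {row _ _ _} {row _ _ _} (p₁ , p₂ , p₃) = sym p₁ , sym p₂ , sym p₃

  infixr 7 _⋆_
  _⋆_ : Carrier → Row F → Row F
  k ⋆ row x y z = row (k * x) (k * y) (k * z)

  record Matrix : Set c where
    constructor matrix
    field
      row₁ row₂ row₃ : Row F

  infixl 6 _⊙_
  _⊙_ : Row F → Matrix → Row F
  row x y z ⊙ matrix (row m₁₁ m₁₂ m₁₃) (row m₂₁ m₂₂ m₂₃) (row m₃₁ m₃₂ m₃₃) =
    row (x * m₁₁ + y * m₂₁ + z * m₃₁) (x * m₁₂ + y * m₂₂ + z * m₃₂) (x * m₁₃ + y * m₂₃ + z * m₃₃)

  infixl 7 _⊗_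
  _⊗_ : Matrix → Matrix → Matrix
  matrix u v w ⊗ N = matrix (u ⊙ N) (v ⊙ N) (w ⊙ N)

  det : Matrix → Carrier
  det (matrix u v w) = det3 F u v w

  ⋆-cong : ∀ k {u v} → u ≋ v → k ⋆ u ≋ k ⋆ v
  ⋆-cong k {row _ _ _} {row _ _ _} (p₁ , p₂ , p₃) = *-congˡ p₁ , *-congˡ p₂ , *-congˡ p₃

  ⋆-⋆ : ∀ k l u → k ⋆ l ⋆ u ≋ (k * l) ⋆ u
  ⋆-⋆ k l (row x y z) = sym (*-assoc k l x) , sym (*-assoc k l y) , sym (*-assoc k l z)

  dot-cong : ∀ x y z {p q r p′ q′ r′} → p ≈ p′ → q ≈ q′ → r ≈ r′ →
             x * p + y * q + z * r ≈ x * p′ + y * q′ + z * r′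
  dot-cong x y z p≈ q≈ r≈ = +-cong (+-cong (*-congˡ p≈) (*-congˡ q≈)) (*-congˡ r≈)

  ⊙-congˡ : ∀ {u v} M → u ≋ v → u ⊙ M ≋ v ⊙ M
  ⊙-congˡ {row x y z} {row x′ y′ z′} (matrix (row m₁₁ m₁₂ m₁₃) (row m₂₁ m₂₂ m₂₃) (row m₃₁ m₃₂ m₃₃))
          (x≈x′ , y≈y′ , z≈z′) =
    dot m₁₁ m₂₁ m₃₁ , dot m₁₂ m₂₂ m₃₂ , dot m₁₃ m₂₃ m₃₃
    where
    dot : ∀ p q r → x * p + y * q + z * r ≈ x′ * p + y′ * q + z′ * r
    dot p q r = +-cong (+-cong (*-congʳ x≈x′) (*-congʳ y≈y′)) (*-congʳ z≈z′)

  ⋆-⊙ : ∀ k u M → k ⋆ (u ⊙ M) ≋ (k ⋆ u) ⊙ M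
  ⋆-⊙ k (row x y z) (matrix (row m₁₁ m₁₂ m₁₃) (row m₂₁ m₂₂ m₂₃) (row m₃₁ m₃₂ m₃₃)) =
    scale-dot m₁₁ m₂₁ m₃₁ , scale-dot m₁₂ m₂₂ m₃₂ , scale-dot m₁₃ m₂₃ m₃₃
    where
    scale-dot : ∀ p q r → k * (x * p + y * q + z * r) ≈ k * x * p + k * y * q + k * z * r
    scale-dot = solve 7 (λ k x y z p q r →
      k :* (x :* p :+ y :* q :+ z :* r) := k :* x :* p :+ k :* y :* q :+ k :* z :* r) refl k x y z

  ⊙-⊗ : ∀ u M N → u ⊙ M ⊙ N ≋ u ⊙ (M ⊗ N)
  ⊙-⊗ (row x y z) (matrix (row m₁₁ m₁₂ m₁₃) (row m₂₁ m₂₂ m₂₃) (row m₃₁ m₃₂ m₃₃))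
      (matrix (row n₁₁ n₁₂ n₁₃) (row n₂₁ n₂₂ n₂₃) (row n₃₁ n₃₂ n₃₃)) =
    dot-assoc n₁₁ n₂₁ n₃₁ , dot-assoc n₁₂ n₂₂ n₃₂ , dot-assoc n₁₃ n₂₃ n₃₃
    where
    dot-assoc : ∀ p q r →
      (x * m₁₁ + y * m₂₁ + z * m₃₁) * p + (x * m₁₂ + y * m₂₂ + z * m₃₂) * q + (x * m₁₃ + y * m₂₃ + z * m₃₃) * r
      ≈ x * (m₁₁ * p + m₁₂ * q + m₁₃ * r) + y * (m₂₁ * p + m₂₂ * q + m₂₃ * r) + z * (m₃₁ * p + m₃₂ * q + m₃₃ * r)
    dot-assoc = solve 15 (λ x y z m₁₁ m₁₂ m₁₃ m₂₁ m₂₂ m₂₃ m₃₁ m₃₂ m₃₃ p q r →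
      (x :* m₁₁ :+ y :* m₂₁ :+ z :* m₃₁) :* p :+ (x :* m₁₂ :+ y :* m₂₂ :+ z :* m₃₂) :* q
        :+ (x :* m₁₃ :+ y :* m₂₃ :+ z :* m₃₃) :* r
      := x :* (m₁₁ :* p :+ m₁₂ :* q :+ m₁₃ :* r) :+ y :* (m₂₁ :* p :+ m₂₂ :* q :+ m₂₃ :* r)
        :+ z :* (m₃₁ :* p :+ m₃₂ :* q :+ m₃₃ :* r)) refl x y z m₁₁ m₁₂ m₁₃ m₂₁ m₂₂ m₂₃ m₃₁ m₃₂ m₃₃

  -- 'det3' in the solver's syntax; its semantics is 'det3' definitionally.
  det3ᴾ : ∀ {n} (u₁ u₂ u₃ v₁ v₂ v₃ w₁ w₂ w₃ : Polynomial n) → Polynomial n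
  det3ᴾ u₁ u₂ u₃ v₁ v₂ v₃ w₁ w₂ w₃ =
    (u₁ :* ((v₂ :* w₃) :- (v₃ :* w₂))) :- (u₂ :* ((v₁ :* w₃) :- (v₃ :* w₁)))
      :+ (u₃ :* ((v₁ :* w₂) :- (v₂ :* w₁)))

  det3-cong : ∀ {u v w u′ v′ w′} → u ≋ u′ → v ≋ v′ → w ≋ w′ → det3 F u v w ≈ det3 F u′ v′ w′
  det3-cong {row _ _ _} {row _ _ _} {row _ _ _} {row _ _ _} {row _ _ _} {row _ _ _}
            (u₁ , u₂ , u₃) (v₁ , v₂ , v₃) (w₁ , w₂ , w₃) =
    +-cong (+-cong (*-cong u₁ (minor₂ v₂ w₃ v₃ w₂)) (-‿cong (*-cong u₂ (minor₂ v₁ w₃ v₃ w₁))))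
           (*-cong u₃ (minor₂ v₁ w₂ v₂ w₁))
    where
    minor₂ : ∀ {a b a′ b′ p q p′ q′} → a ≈ a′ → b ≈ b′ → p ≈ p′ → q ≈ q′ → a * b - p * q ≈ a′ * b′ - p′ * q′
    minor₂ a b p q = +-cong (*-cong a b) (-‿cong (*-cong p q))

  det3-⋆ : ∀ k l m u v w → det3 F (k ⋆ u) (l ⋆ v) (m ⋆ w) ≈ (k * l * m) * det3 F u v w
  det3-⋆ k l m (row u₁ u₂ u₃) (row v₁ v₂ v₃) (row w₁ w₂ w₃) =
    solve 12 (λ k l m u₁ u₂ u₃ v₁ v₂ v₃ w₁ w₂ w₃ →
      det3ᴾ (k :* u₁) (k :* u₂) (k :* u₃) (l :* v₁) (l :* v₂) (l :* v₃) (m :* w₁) (m :* w₂) (m :* w₃)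
      := k :* l :* m :* det3ᴾ u₁ u₂ u₃ v₁ v₂ v₃ w₁ w₂ w₃) refl k l m u₁ u₂ u₃ v₁ v₂ v₃ w₁ w₂ w₃

  det3-⊙ : ∀ u v w M → det3 F (u ⊙ M) (v ⊙ M) (w ⊙ M) ≈ det3 F u v w * det M
  det3-⊙ (row u₁ u₂ u₃) (row v₁ v₂ v₃) (row w₁ w₂ w₃)
         (matrix (row m₁₁ m₁₂ m₁₃) (row m₂₁ m₂₂ m₂₃) (row m₃₁ m₃₂ m₃₃)) =
    solve 18 (λ u₁ u₂ u₃ v₁ v₂ v₃ w₁ w₂ w₃ m₁₁ m₁₂ m₁₃ m₂₁ m₂₂ m₂₃ m₃₁ m₃₂ m₃₃ →
      det3ᴾ (u₁ :* m₁₁ :+ u₂ :* m₂₁ :+ u₃ :* m₃₁) (u₁ :* m₁₂ :+ u₂ :* m₂₂ :+ u₃ :* m₃₂) (u₁ :* m₁₃ :+ u₂ :* m₂₃ :+ u₃ :* m₃₃)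
            (v₁ :* m₁₁ :+ v₂ :* m₂₁ :+ v₃ :* m₃₁) (v₁ :* m₁₂ :+ v₂ :* m₂₂ :+ v₃ :* m₃₂) (v₁ :* m₁₃ :+ v₂ :* m₂₃ :+ v₃ :* m₃₃)
            (w₁ :* m₁₁ :+ w₂ :* m₂₁ :+ w₃ :* m₃₁) (w₁ :* m₁₂ :+ w₂ :* m₂₂ :+ w₃ :* m₃₂) (w₁ :* m₁₃ :+ w₂ :* m₂₃ :+ w₃ :* m₃₃)
      := det3ᴾ u₁ u₂ u₃ v₁ v₂ v₃ w₁ w₂ w₃ :* det3ᴾ m₁₁ m₁₂ m₁₃ m₂₁ m₂₂ m₂₃ m₃₁ m₃₂ m₃₃)
      refl u₁ u₂ u₃ v₁ v₂ v₃ w₁ w₂ w₃ m₁₁ m₁₂ m₁₃ m₂₁ m₂₂ m₂₃ m₃₁ m₃₂ m₃₃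

  det-⊗ : ∀ M N → det (M ⊗ N) ≈ det M * det N
  det-⊗ (matrix u v w) N = det3-⊙ u v w N

  record ProjEquiv (σ : Fin 7 → Fin 7) (ψ′ ψ : Param F) : Set (c ⊔ ℓ₁) where
    field
      M       : Matrix
      det≉0   : det M ≉ 0#
      scale   : Fin 7 → Carrier
      scale≉0 : ∀ i → scale i ≉ 0#
      rows    : ∀ i → scale i ⋆ W F ψ′ i ≋ W F ψ (σ i) ⊙ M

  projEquiv-trans : ∀ {σ τ ψ″ ψ′ ψ} → ProjEquiv σ ψ″ ψ′ → ProjEquiv τ ψ′ ψ → ProjEquiv (τ ∘ σ) ψ″ ψ
  projEquiv-trans {σ} {τ} {ψ″} {ψ′} {ψ} e₁ e₂ = record
    { M       = E₂.M ⊗ E₁.M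
    ; det≉0   = λ eq → *-≉0 E₂.det≉0 E₁.det≉0 (trans (sym (det-⊗ E₂.M E₁.M)) eq)
    ; scale   = λ i → E₂.scale (σ i) * E₁.scale i
    ; scale≉0 = λ i → *-≉0 (E₂.scale≉0 (σ i)) (E₁.scale≉0 i)
    ; rows    = rows
    }
    where
    module E₁ = ProjEquiv e₁
    module E₂ = ProjEquiv e₂
    rows : ∀ i → (E₂.scale (σ i) * E₁.scale i) ⋆ W F ψ″ i ≋ W F ψ (τ (σ i)) ⊙ (E₂.M ⊗ E₁.M)
    rows i = ≋-trans (≋-sym (⋆-⋆ (E₂.scale (σ i)) (E₁.scale i) (W F ψ″ i)))
            (≋-trans (⋆-cong (E₂.scale (σ i)) (E₁.rows i))
            (≋-trans (⋆-⊙ (E₂.scale (σ i)) (W F ψ′ (σ i)) E₁.M)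
            (≋-trans (⊙-congˡ E₁.M (E₂.rows (σ i)))
                     (⊙-⊗ (W F ψ (τ (σ i))) E₂.M E₁.M))))

  minor : Param F → Fin 7 → Fin 7 → Fin 7 → Carrier
  minor ψ r s t = det3 F (W F ψ r) (W F ψ s) (W F ψ t)

  minor-projEquiv : ∀ {σ ψ′ ψ} → ProjEquiv σ ψ′ ψ → ∀ r s t →
                    minor ψ (σ r) (σ s) (σ t) ≉ 0# → minor ψ′ r s t ≉ 0#
  minor-projEquiv {σ} {ψ′} {ψ} e r s t m≉0 m′≈0 = *-≉0 m≉0 det≉0 (begin
    minor ψ (σ r) (σ s) (σ t) * det M
      ≈⟨ det3-⊙ (W F ψ (σ r)) (W F ψ (σ s)) (W F ψ (σ t)) M ⟨
    det3 F (W F ψ (σ r) ⊙ M) (W F ψ (σ s) ⊙ M) (W F ψ (σ t) ⊙ M)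
      ≈⟨ det3-cong (rows r) (rows s) (rows t) ⟨
    det3 F (scale r ⋆ W F ψ′ r) (scale s ⋆ W F ψ′ s) (scale t ⋆ W F ψ′ t)
      ≈⟨ det3-⋆ (scale r) (scale s) (scale t) (W F ψ′ r) (W F ψ′ s) (W F ψ′ t) ⟩
    scale r * scale s * scale t * minor ψ′ r s t
      ≈⟨ *-congˡ m′≈0 ⟩
    scale r * scale s * scale t * 0#
      ≈⟨ zeroʳ _ ⟩
    0# ∎)
    where open ProjEquiv e

  NonDegenerate : Param F → Set ℓ₁
  NonDegenerate ψ = ∀ i j → ¬ (i ≡ pred7 F j) → ¬ (i ≡ j) → 𝒱 F ψ i j ≉ 0#

  positive⇒nonDegenerate : ∀ {ψ} → Positive F ψ → NonDegenerate ψ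
  positive⇒nonDegenerate pos i j i≢j-1 i≢j 𝒱≈0 = irrefl (sym 𝒱≈0) (pos i j i≢j-1 i≢j)

  suc7 : Fin 7 → Fin 7
  suc7 0F = 1F
  suc7 1F = 2F
  suc7 2F = 3F
  suc7 3F = 4F
  suc7 4F = 5F
  suc7 5F = 6F
  suc7 6F = 0F

  suc7-pred7 : ∀ i → suc7 (pred7 F i) ≡ i
  suc7-pred7 0F = ≡.refl
  suc7-pred7 1F = ≡.refl
  suc7-pred7 2F = ≡.refl
  suc7-pred7 3F = ≡.refl
  suc7-pred7 4F = ≡.refl
  suc7-pred7 5F = ≡.refl
  suc7-pred7 6F = ≡.refl

  pred7-injective : ∀ {i j} → pred7 F i ≡ pred7 F j → i ≡ j
  pred7-injective {i} {j} eq = ≡.trans (≡.sym (suc7-pred7 i)) (≡.trans (≡.cong suc7 eq) (suc7-pred7 j))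

  nonDegenerate-projEquiv : ∀ {ψ′ ψ} → ProjEquiv (pred7 F) ψ′ ψ → NonDegenerate ψ → NonDegenerate ψ′
  nonDegenerate-projEquiv e nd i j i≢j-1 i≢j =
    minor-projEquiv e (pred7 F i) (pred7 F (pred7 F j)) (pred7 F j)
      (nd (pred7 F i) (pred7 F j) (i≢j-1 ∘ pred7-injective) (i≢j ∘ pred7-injective))

  frame-column : ∀ {p q r v₀ v₁ v₂} →
    v₀ ≈ 0# * p + 1# * q + 1# * r → v₁ ≈ 0# * p + 0# * q + 1# * r → v₂ ≈ 1# * p + 0# * q + 0# * r →
    (p ≈ v₂) × (q ≈ v₀ - v₁) × (r ≈ v₁)
  frame-column {p} {q} {r} h₀ h₁ h₂ =
    trans (solve 3 (λ p q r → p := :1 :* p :+ :0 :* q :+ :0 :* r) refl p q r) (sym h₂) ,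
    trans (solve 3 (λ p q r → q := (:0 :* p :+ :1 :* q :+ :1 :* r) :- (:0 :* p :+ :0 :* q :+ :1 :* r)) refl p q r)
          (+-cong (sym h₀) (-‿cong (sym h₁))) ,
    trans (solve 3 (λ p q r → r := :0 :* p :+ :0 :* q :+ :1 :* r) refl p q r) (sym h₁)

  frame-relation : ∀ {p q r v₀ v₁ v₂ v₃} →
    v₀ ≈ 0# * p + 1# * q + 1# * r → v₁ ≈ 0# * p + 0# * q + 1# * r →
    v₂ ≈ 1# * p + 0# * q + 0# * r → v₃ ≈ 1# * p + 1# * q + 0# * r → v₃ ≈ v₂ + v₀ - v₁
  frame-relation {p} {q} {r} h₀ h₁ h₂ h₃ = begin
    _                                                    ≈⟨ h₃ ⟩
    1# * p + 1# * q + 0# * r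
      ≈⟨ solve 3 (λ p q r →
           :1 :* p :+ :1 :* q :+ :0 :* r
           := (:1 :* p :+ :0 :* q :+ :0 :* r) :+ (:0 :* p :+ :1 :* q :+ :1 :* r) :- (:0 :* p :+ :0 :* q :+ :1 :* r))
           refl p q r ⟩
    (1# * p + 0# * q + 0# * r) + (0# * p + 1# * q + 1# * r) - (0# * p + 0# * q + 1# * r)
      ≈⟨ +-cong (+-cong h₂ h₀) (-‿cong h₁) ⟨
    _                                                    ∎

  frame-scalar : ∀ M {s₀ s₁ s₂ s₃} →
    s₀ ⋆ row 0# 1# 1# ≋ row 0# 1# 1# ⊙ M → s₁ ⋆ row 0# 0# 1# ≋ row 0# 0# 1# ⊙ M →
    s₂ ⋆ row 1# 0# 0# ≋ row 1# 0# 0# ⊙ M → s₃ ⋆ row 1# 1# 0# ≋ row 1# 1# 0# ⊙ M →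
    ∀ u → u ⊙ M ≋ s₀ ⋆ u
  frame-scalar (matrix (row m₁₁ m₁₂ m₁₃) (row m₂₁ m₂₂ m₂₃) (row m₃₁ m₃₂ m₃₃)) {s₀} {s₁} {s₂} {s₃}
               (h₀₁ , h₀₂ , h₀₃) (h₁₁ , h₁₂ , h₁₃) (h₂₁ , h₂₂ , h₂₃) (h₃₁ , h₃₂ , h₃₃) (row x y z) =
    first , second , third
    where
    s₂≈s₀ : s₂ ≈ s₀
    s₂≈s₀ = begin
      s₂                          ≈⟨ solve 3 (λ s₀ s₁ s₂ → s₂ := s₂ :* :1 :+ s₀ :* :0 :- s₁ :* :0) refl s₀ s₁ s₂ ⟩
      s₂ * 1# + s₀ * 0# - s₁ * 0# ≈⟨ frame-relation h₀₁ h₁₁ h₂₁ h₃₁ ⟨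
      s₃ * 1#                     ≈⟨ frame-relation h₀₂ h₁₂ h₂₂ h₃₂ ⟩
      s₂ * 0# + s₀ * 1# - s₁ * 0# ≈⟨ solve 3 (λ s₀ s₁ s₂ → s₂ :* :0 :+ s₀ :* :1 :- s₁ :* :0 := s₀) refl s₀ s₁ s₂ ⟩
      s₀                          ∎

    s₀-s₁≈0 : s₀ - s₁ ≈ 0#
    s₀-s₁≈0 = begin
      s₀ - s₁                     ≈⟨ solve 3 (λ s₀ s₁ s₂ → s₀ :- s₁ := s₂ :* :0 :+ s₀ :* :1 :- s₁ :* :1) refl s₀ s₁ s₂ ⟩
      s₂ * 0# + s₀ * 1# - s₁ * 1# ≈⟨ frame-relation h₀₃ h₁₃ h₂₃ h₃₃ ⟨
      s₃ * 0#                     ≈⟨ zeroʳ s₃ ⟩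
      0#                          ∎

    entries : ∀ {p q r p′ q′ r′} → (p ≈ p′) × (q ≈ q′) × (r ≈ r′) → x * p + y * q + z * r ≈ x * p′ + y * q′ + z * r′
    entries (p≈ , q≈ , r≈) = dot-cong x y z p≈ q≈ r≈

    first : x * m₁₁ + y * m₂₁ + z * m₃₁ ≈ s₀ * x
    first = begin
      x * m₁₁ + y * m₂₁ + z * m₃₁
        ≈⟨ entries (frame-column h₀₁ h₁₁ h₂₁) ⟩
      x * (s₂ * 1#) + y * (s₀ * 0# - s₁ * 0#) + z * (s₁ * 0#)
        ≈⟨ solve 6 (λ x y z s₀ s₁ s₂ →
             x :* (s₂ :* :1) :+ y :* (s₀ :* :0 :- s₁ :* :0) :+ z :* (s₁ :* :0) := s₂ :* x) refl x y z s₀ s₁ s₂ ⟩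
      s₂ * x
        ≈⟨ *-congʳ s₂≈s₀ ⟩
      s₀ * x ∎

    second : x * m₁₂ + y * m₂₂ + z * m₃₂ ≈ s₀ * y
    second = begin
      x * m₁₂ + y * m₂₂ + z * m₃₂
        ≈⟨ entries (frame-column h₀₂ h₁₂ h₂₂) ⟩
      x * (s₂ * 0#) + y * (s₀ * 1# - s₁ * 0#) + z * (s₁ * 0#)
        ≈⟨ solve 6 (λ x y z s₀ s₁ s₂ →
             x :* (s₂ :* :0) :+ y :* (s₀ :* :1 :- s₁ :* :0) :+ z :* (s₁ :* :0) := s₀ :* y) refl x y z s₀ s₁ s₂ ⟩
      s₀ * y ∎

    third : x * m₁₃ + y * m₂₃ + z * m₃₃ ≈ s₀ * z
    third = begin
      x * m₁₃ + y * m₂₃ + z * m₃₃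
        ≈⟨ entries (frame-column h₀₃ h₁₃ h₂₃) ⟩
      x * (s₂ * 0#) + y * (s₀ * 1# - s₁ * 1#) + z * (s₁ * 1#)
        ≈⟨ solve 6 (λ x y z s₀ s₁ s₂ →
             x :* (s₂ :* :0) :+ y :* (s₀ :* :1 :- s₁ :* :1) :+ z :* (s₁ :* :1)
             := s₀ :* z :+ (s₀ :- s₁) :* (y :- z)) refl x y z s₀ s₁ s₂ ⟩
      s₀ * z + (s₀ - s₁) * (y - z)
        ≈⟨ +-congˡ (trans (*-congʳ s₀-s₁≈0) (zeroˡ (y - z))) ⟩
      s₀ * z + 0#
        ≈⟨ +-identityʳ (s₀ * z) ⟩
      s₀ * z ∎

  chart-cancel : ∀ {k l a b a′ b′} → l ≉ 0# → k ⋆ row a′ 1# b′ ≋ l ⋆ row a 1# b → (a′ ≈ a) × (b′ ≈ b)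
  chart-cancel {k} {l} l≉0 (ka′≈la , k≈l , kb′≈lb) =
    *-cancelˡ l≉0 (trans (*-congʳ (sym k≈l′)) ka′≈la) ,
    *-cancelˡ l≉0 (trans (*-congʳ (sym k≈l′)) kb′≈lb)
    where
    k≈l′ : k ≈ l
    k≈l′ = trans (sym (*-identityʳ k)) (trans k≈l (*-identityʳ l))

  infix 4 _≈ᴾ_
  _≈ᴾ_ : Param F → Param F → Set ℓ₁
  ψ′ ≈ᴾ ψ = (a₁ ψ′ ≈ a₁ ψ) × (a₂ ψ′ ≈ a₂ ψ) × (a₃ ψ′ ≈ a₃ ψ) × (b₁ ψ′ ≈ b₁ ψ) × (b₂ ψ′ ≈ b₂ ψ) × (b₃ ψ′ ≈ b₃ ψ)

  frame-rigidity : ∀ {σ ψ′ ψ} → ProjEquiv σ ψ′ ψ → σ ≗ (λ i → i) → ψ′ ≈ᴾ ψ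
  frame-rigidity {σ} {ψ′} {ψ} e σ≗id =
    let a₁≈ , b₁≈ = chart-cancel (scale≉0 0F) (fixed 4F)
        a₂≈ , b₂≈ = chart-cancel (scale≉0 0F) (fixed 5F)
        a₃≈ , b₃≈ = chart-cancel (scale≉0 0F) (fixed 6F)
    in a₁≈ , a₂≈ , a₃≈ , b₁≈ , b₂≈ , b₃≈
    where
    open ProjEquiv e
    rows′ : ∀ i → scale i ⋆ W F ψ′ i ≋ W F ψ i ⊙ M
    rows′ i = ≡.subst (λ k → scale i ⋆ W F ψ′ i ≋ W F ψ k ⊙ M) (σ≗id i) (rows i)
    fixed : ∀ i → scale i ⋆ W F ψ′ i ≋ scale 0F ⋆ W F ψ i
    fixed i = ≋-trans (rows′ i) (frame-scalar M (rows′ 0F) (rows′ 1F) (rows′ 2F) (rows′ 3F) (W F ψ i))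

  -- shiftMatrix ψ is determined by sending W ψ 6F, W ψ 0F, W ψ 1F, W ψ 2F to
  -- multiples of the frame rows W 0F, W 1F, W 2F, W 3F.

  shiftMatrix : Param F → Matrix
  shiftMatrix (param _ _ x₃ _ _ y₃) =
    matrix (row (1# - y₃) (1# - y₃) 0#) (row (- x₃) 0# (x₃ * (1# - y₃))) (row x₃ 0# 0#)

  shiftScale : Param F → Fin 7 → Carrier
  shiftScale (param _  _  x₃ _ _ y₃) 0F = x₃ * (1# - y₃)
  shiftScale (param _  _  x₃ _ _ y₃) 1F = x₃ * (1# - y₃)
  shiftScale (param _  _  x₃ _ _ _ ) 2F = x₃
  shiftScale (param _  _  _  _ _ y₃) 3F = 1# - y₃
  shiftScale (param _  _  _  _ _ y₃) 4F = 1# - y₃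
  shiftScale (param x₁ _  _  _ _ y₃) 5F = x₁ - x₁ * y₃
  shiftScale (param _  x₂ _  _ _ y₃) 6F = x₂ - x₂ * y₃

  det-shiftMatrix : ∀ ψ → det (shiftMatrix ψ) ≈ (a₃ ψ * (1# - b₃ ψ)) * (a₃ ψ * (1# - b₃ ψ))
  det-shiftMatrix (param _ _ x₃ _ _ y₃) = solve 2 (λ x₃ y₃ →
    det3ᴾ (:1 :- y₃) (:1 :- y₃) :0 (:- x₃) :0 (x₃ :* (:1 :- y₃)) x₃ :0 :0
    := (x₃ :* (:1 :- y₃)) :* (x₃ :* (:1 :- y₃))) refl x₃ y₃

  x-xy≉0 : ∀ {x y} → x ≉ 0# → 1# - y ≉ 0# → x - x * y ≉ 0#
  x-xy≉0 {x} {y} x≉0 1-y≉0 eq = *-≉0 x≉0 1-y≉0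
    (trans (solve 2 (λ x y → x :* (:1 :- y) := x :- x :* y) refl x y) eq)

  chart-row-step : ∀ ψ x y → x ≉ 0# → 1# - b₃ ψ ≉ 0# →
    (x - x * b₃ ψ) ⋆ row (((x - x * b₃ ψ) - a₃ ψ + a₃ ψ * y) ÷ (x - x * b₃ ψ)) 1# (a₃ ψ ÷ x)
      ≋ row x 1# y ⊙ shiftMatrix ψ
  chart-row-step (param _ _ x₃ _ _ y₃) x y x≉0 1-y₃≉0 = first , second , third
    where
    first : (x - x * y₃) * (((x - x * y₃) - x₃ + x₃ * y) ÷ (x - x * y₃))
            ≈ x * (1# - y₃) + 1# * - x₃ + y * x₃
    first = trans (*-÷-cancel _ (x-xy≉0 x≉0 1-y₃≉0)) (solve 4 (λ x y x₃ y₃ →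
      (x :- x :* y₃) :- x₃ :+ x₃ :* y := x :* (:1 :- y₃) :+ :1 :* (:- x₃) :+ y :* x₃) refl x y x₃ y₃)
    second : (x - x * y₃) * 1# ≈ x * (1# - y₃) + 1# * 0# + y * 0#
    second = solve 3 (λ x y y₃ →
      (x :- x :* y₃) :* :1 := x :* (:1 :- y₃) :+ :1 :* :0 :+ y :* :0) refl x y y₃
    third : (x - x * y₃) * (x₃ ÷ x) ≈ x * 0# + 1# * (x₃ * (1# - y₃)) + y * 0#
    third = begin
      (x - x * y₃) * (x₃ ÷ x)
        ≈⟨ solve 3 (λ x y₃ q → (x :- x :* y₃) :* q := (:1 :- y₃) :* (x :* q)) refl x y₃ (x₃ ÷ x) ⟩
      (1# - y₃) * (x * (x₃ ÷ x))
        ≈⟨ *-congˡ (*-÷-cancel x₃ x≉0) ⟩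
      (1# - y₃) * x₃
        ≈⟨ solve 4 (λ x y x₃ y₃ →
             (:1 :- y₃) :* x₃ := x :* :0 :+ :1 :* (x₃ :* (:1 :- y₃)) :+ y :* :0) refl x y x₃ y₃ ⟩
      x * 0# + 1# * (x₃ * (1# - y₃)) + y * 0# ∎

  step-rows : ∀ ψ → a₁ ψ ≉ 0# → a₂ ψ ≉ 0# → 1# - b₃ ψ ≉ 0# →
              ∀ i → shiftScale ψ i ⋆ W F (step F ψ) i ≋ W F ψ (pred7 F i) ⊙ shiftMatrix ψ
  step-rows ψ@(param x₁ x₂ x₃ y₁ y₂ y₃) x₁≉0 x₂≉0 1-y₃≉0 = λ where
    0F → solve 2 (λ x₃ y₃ → x₃ :* (:1 :- y₃) :* :0 := x₃ :* (:1 :- y₃) :+ :1 :* (:- x₃) :+ y₃ :* x₃) refl x₃ y₃ ,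
         solve 2 (λ x₃ y₃ → x₃ :* (:1 :- y₃) :* :1 := x₃ :* (:1 :- y₃) :+ :1 :* :0 :+ y₃ :* :0) refl x₃ y₃ ,
         solve 2 (λ x₃ y₃ → x₃ :* (:1 :- y₃) :* :1 := x₃ :* :0 :+ :1 :* (x₃ :* (:1 :- y₃)) :+ y₃ :* :0) refl x₃ y₃
    1F → solve 2 (λ x₃ y₃ → x₃ :* (:1 :- y₃) :* :0 := :0 :* (:1 :- y₃) :+ :1 :* (:- x₃) :+ :1 :* x₃) refl x₃ y₃ ,
         solve 2 (λ x₃ y₃ → x₃ :* (:1 :- y₃) :* :0 := :0 :* (:1 :- y₃) :+ :1 :* :0 :+ :1 :* :0) refl x₃ y₃ ,
         solve 2 (λ x₃ y₃ → x₃ :* (:1 :- y₃) :* :1 := :0 :* :0 :+ :1 :* (x₃ :* (:1 :- y₃)) :+ :1 :* :0) refl x₃ y₃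
    2F → solve 2 (λ x₃ y₃ → x₃ :* :1 := :0 :* (:1 :- y₃) :+ :0 :* (:- x₃) :+ :1 :* x₃) refl x₃ y₃ ,
         solve 2 (λ x₃ y₃ → x₃ :* :0 := :0 :* (:1 :- y₃) :+ :0 :* :0 :+ :1 :* :0) refl x₃ y₃ ,
         solve 2 (λ x₃ y₃ → x₃ :* :0 := :0 :* :0 :+ :0 :* (x₃ :* (:1 :- y₃)) :+ :1 :* :0) refl x₃ y₃
    3F → solve 2 (λ x₃ y₃ → (:1 :- y₃) :* :1 := :1 :* (:1 :- y₃) :+ :0 :* (:- x₃) :+ :0 :* x₃) refl x₃ y₃ ,
         solve 2 (λ x₃ y₃ → (:1 :- y₃) :* :1 := :1 :* (:1 :- y₃) :+ :0 :* :0 :+ :0 :* :0) refl x₃ y₃ ,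
         solve 2 (λ x₃ y₃ → (:1 :- y₃) :* :0 := :1 :* :0 :+ :0 :* (x₃ :* (:1 :- y₃)) :+ :0 :* :0) refl x₃ y₃
    4F → trans (*-÷-cancel (1# - x₃ - y₃) 1-y₃≉0)
               (solve 2 (λ x₃ y₃ → :1 :- x₃ :- y₃ := :1 :* (:1 :- y₃) :+ :1 :* (:- x₃) :+ :0 :* x₃) refl x₃ y₃) ,
         solve 2 (λ x₃ y₃ → (:1 :- y₃) :* :1 := :1 :* (:1 :- y₃) :+ :1 :* :0 :+ :0 :* :0) refl x₃ y₃ ,
         solve 2 (λ x₃ y₃ → (:1 :- y₃) :* x₃ := :1 :* :0 :+ :1 :* (x₃ :* (:1 :- y₃)) :+ :0 :* :0) refl x₃ y₃
    5F → chart-row-step ψ x₁ y₁ x₁≉0 1-y₃≉0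
    6F → chart-row-step ψ x₂ y₂ x₂≉0 1-y₃≉0

  nonDegenerate-denominators : ∀ {ψ} → NonDegenerate ψ →
    (a₁ ψ ≉ 0#) × (a₂ ψ ≉ 0#) × (a₃ ψ ≉ 0#) × (1# - b₃ ψ ≉ 0#)
  nonDegenerate-denominators {param x₁ x₂ x₃ y₁ y₂ y₃} nd =
    (λ x₁≈0 → nd 5F 2F (λ ()) (λ ()) (trans 𝒱₅₂≈x₁ x₁≈0)) ,
    (λ x₂≈0 → nd 6F 2F (λ ()) (λ ()) (trans 𝒱₆₂≈x₂ x₂≈0)) ,
    (λ x₃≈0 → nd 2F 1F (λ ()) (λ ()) (trans 𝒱₂₁≈x₃ x₃≈0)) ,
    (λ 1-y₃≈0 → nd 3F 1F (λ ()) (λ ()) (trans 𝒱₃₁≈1-y₃ 1-y₃≈0))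
    where
    𝒱₅₂≈x₁ : det3 F (row x₁ 1# y₁) (row 0# 1# 1#) (row 0# 0# 1#) ≈ x₁
    𝒱₅₂≈x₁ = solve 2 (λ x y → det3ᴾ x :1 y :0 :1 :1 :0 :0 :1 := x) refl x₁ y₁
    𝒱₆₂≈x₂ : det3 F (row x₂ 1# y₂) (row 0# 1# 1#) (row 0# 0# 1#) ≈ x₂
    𝒱₆₂≈x₂ = solve 2 (λ x y → det3ᴾ x :1 y :0 :1 :1 :0 :0 :1 := x) refl x₂ y₂
    𝒱₂₁≈x₃ : det3 F (row 0# 0# 1#) (row x₃ 1# y₃) (row 0# 1# 1#) ≈ x₃
    𝒱₂₁≈x₃ = solve 2 (λ x y → det3ᴾ :0 :0 :1 x :1 y :0 :1 :1 := x) refl x₃ y₃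
    𝒱₃₁≈1-y₃ : det3 F (row 1# 0# 0#) (row x₃ 1# y₃) (row 0# 1# 1#) ≈ 1# - y₃
    𝒱₃₁≈1-y₃ = solve 2 (λ x y → det3ᴾ :1 :0 :0 x :1 y :0 :1 :1 := :1 :- y) refl x₃ y₃

  step-projEquiv : ∀ {ψ} → NonDegenerate ψ → ProjEquiv (pred7 F) (step F ψ) ψ
  step-projEquiv {ψ} nd with nonDegenerate-denominators nd
  ... | x₁≉0 , x₂≉0 , x₃≉0 , 1-y₃≉0 = record
    { M       = shiftMatrix ψ
    ; det≉0   = λ eq → *-≉0 x₃[1-y₃]≉0 x₃[1-y₃]≉0 (trans (sym (det-shiftMatrix ψ)) eq)
    ; scale   = shiftScale ψ
    ; scale≉0 = λ where
        0F → x₃[1-y₃]≉0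
        1F → x₃[1-y₃]≉0
        2F → x₃≉0
        3F → 1-y₃≉0
        4F → 1-y₃≉0
        5F → x-xy≉0 x₁≉0 1-y₃≉0
        6F → x-xy≉0 x₂≉0 1-y₃≉0
    ; rows    = step-rows ψ x₁≉0 x₂≉0 1-y₃≉0
    }
    where
    x₃[1-y₃]≉0 : a₃ ψ * (1# - b₃ ψ) ≉ 0#
    x₃[1-y₃]≉0 = *-≉0 x₃≉0 1-y₃≉0

  step-nonDegenerate : ∀ {ψ} → NonDegenerate ψ → NonDegenerate (step F ψ)
  step-nonDegenerate nd = nonDegenerate-projEquiv (step-projEquiv nd) nd

  seq-nonDegenerate : ∀ {ψ} → NonDegenerate ψ → ∀ t → NonDegenerate (seq F ψ t)
  seq-nonDegenerate nd zero    = nd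
  seq-nonDegenerate nd (suc t) = step-nonDegenerate (seq-nonDegenerate nd t)

  rotate : ℕ → Fin 7 → Fin 7
  rotate zero    i = i
  rotate (suc t) i = rotate t (pred7 F i)

  rotate-7 : rotate 7 ≗ (λ i → i)
  rotate-7 0F = ≡.refl
  rotate-7 1F = ≡.refl
  rotate-7 2F = ≡.refl
  rotate-7 3F = ≡.refl
  rotate-7 4F = ≡.refl
  rotate-7 5F = ≡.refl
  rotate-7 6F = ≡.refl

  seq-projEquiv : ∀ {ψ} → NonDegenerate ψ → ∀ t → ProjEquiv (rotate (suc t)) (seq F ψ (suc t)) ψ
  seq-projEquiv nd zero    = step-projEquiv nd
  seq-projEquiv nd (suc t) =
    projEquiv-trans (step-projEquiv (seq-nonDegenerate nd (suc t))) (seq-projEquiv nd t)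

lemma2p8 : ∀ {c ℓ₁ ℓ₂ : Level} (F : OrderedField c ℓ₁ ℓ₂) (ψ : Param F) → Positive F ψ → let open OrderedField F in (a₁ (seq F ψ 7) ≈ a₁ ψ) × (a₂ (seq F ψ 7) ≈ a₂ ψ) × (a₃ (seq F ψ 7) ≈ a₃ ψ) × (b₁ (seq F ψ 7) ≈ b₁ ψ) × (b₂ (seq F ψ 7) ≈ b₂ ψ) × (b₃ (seq F ψ 7) ≈ b₃ ψ)
lemma2p8 F ψ pos = frame-rigidity F (seq-projEquiv F (positive⇒nonDegenerate F pos) 6) (rotate-7 F)
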